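{- Let $m,n\geq 4$ be integers with $mn\equiv 2 \pmod 3$. Let $D$ be a domino (two edge-adjacent unit squares) contained in the $m\times n$ rectangle such that one of the two squares of $D$ is a corner square of the rectangle, and $D$ may be either horizontal or vertical. Then the region obtained from the $m\times n$ rectangle by removing $D$ can be tiled by right trominoes.
   Context: A right tromino is the L-shaped figure formed by three unit squares, i.e. a $2\times 2$ square with one unit square removed; copies may be rotated and reflected. A region is tiled by right trominoes if it is covered by copies of the right tromino with disjoint interiors, each copy being a union of three unit cells of the grid. The $m\times n$ rectangle consists of $m$ rows and $n$ columns of unit squares. -}

module Defs where

open import Data.Nat using (ℕ; zero; suc; _+_; _<_)
open import Data.Fin using (Fin; zero; suc)
open import Data.Product using (_×_; _,_; ∃)
open import Data.Sum using (_⊎_)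
open import Data.List using (List; []; _∷_; concatMap)
open import Data.List.Membership.Propositional using (_∈_)
open import Data.List.Relation.Unary.Unique.Propositional using (Unique)
open import Relation.Binary.PropositionalEquality using (_≡_)
open import Relation.Nullary using (¬_)

-- A unit cell of the grid: (row , column), 0-indexed.
Cell : Set
Cell = ℕ × ℕ

InRect : ℕ → ℕ → Cell → Set
InRect m n (r , c) = r < m × c < n

Adjacent : Cell → Cell → Set
Adjacent (r , c) (r' , c') =
  (r ≡ r' × (suc c ≡ c' ⊎ suc c' ≡ c)) ⊎ (c ≡ c' × (suc r ≡ r' ⊎ suc r' ≡ r))

IsCorner : ℕ → ℕ → Cell → Set
IsCorner m n (r , c) = (r ≡ 0 ⊎ suc r ≡ m) × (c ≡ 0 ⊎ suc c ≡ n)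

-- A placed right tromino: the 2×2 block with top-left cell 'anchor',
-- with one of its four cells removed (this covers all rotations/reflections).
record Tromino : Set where
  constructor tromino
  field
    anchor  : Cell
    missing : Fin 4

cells : Tromino → List Cell
cells (tromino (r , c) zero)                   = (r , suc c) ∷ (suc r , c) ∷ (suc r , suc c) ∷ []
cells (tromino (r , c) (suc zero))             = (r , c) ∷ (suc r , c) ∷ (suc r , suc c) ∷ []
cells (tromino (r , c) (suc (suc zero)))       = (r , c) ∷ (r , suc c) ∷ (suc r , suc c) ∷ []
cells (tromino (r , c) (suc (suc (suc zero)))) = (r , c) ∷ (r , suc c) ∷ (suc r , c) ∷ []

-- A list of trominoes tiles the region R (a set of cells) iff the cells of
-- all the trominoes, listed with multiplicity, are pairwise distinct
-- (disjoint interiors), all lie in R, and cover R.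
Tiles : List Tromino → (Cell → Set) → Set
Tiles T R =
  Unique (concatMap cells T)
  × (∀ x → x ∈ concatMap cells T → R x)
  × (∀ x → R x → x ∈ concatMap cells T)

RectMinus : ℕ → ℕ → Cell → Cell → Cell → Set
RectMinus m n p q x = InRect m n x × ¬ (x ≡ p) × ¬ (x ≡ q)

TileableByRightTrominoes : (Cell → Set) → Set
TileableByRightTrominoes R = ∃ λ (T : List Tromino) → Tiles T R

-- By transposition we may assume m ≡ 1 and n ≡ 2 (mod 3).  The 2 × 6 and 3 × 6 rectangles are
-- tileable, hence so is every k × 6 and 6 × k rectangle with k ≥ 2.  Gluing such a 6-strip to the
-- side of the rectangle away from the removed corner domino reduces m × n to (m − 6) × n or to
-- m × (n − 6), so only the rectangles 4 × 5, 4 × 8, 7 × 5 and 7 × 8 remain; for each of them the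
-- tilings of all eight positions of a corner domino are verified by computation.

module Submission where

open import Defs
open import Data.Empty using (⊥-elim)
open import Data.Fin using (zero; suc; #_)
open import Data.List using (List; []; _∷_; _++_; map; concatMap; upTo)
open import Data.List.Membership.Propositional using (_∈_)
open import Data.List.Membership.Propositional.Properties
  using (∈-++⁻; ∈-++⁺ˡ; ∈-++⁺ʳ; ∈-map⁺; ∈-map⁻; ∈-concat⁺′; ∈-upTo⁺)
open import Data.List.Properties using (concatMap-++; map-++)
open import Data.List.Relation.Binary.Permutation.Propositional
  using (_↭_; ↭-refl; ↭-sym; ↭-trans; ↭-reflexive; ↭-prep; ↭-swap; ↭⇒↭ₛ)
open import Data.List.Relation.Binary.Permutation.Propositional.Properties using (∈-resp-↭; ++⁺)
import Data.List.Relation.Binary.Permutation.Setoid.Properties as Permutationₛ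
open import Data.List.Relation.Unary.All as All using (All; all?)
open import Data.List.Relation.Unary.Any using (Any; here; there; any?; satisfied)
open import Data.List.Relation.Unary.Unique.Propositional using (Unique)
import Data.List.Relation.Unary.Unique.Propositional.Properties as Unique
open import Data.Nat
  using (ℕ; zero; suc; pred; _+_; _*_; _%_; _/_; _∸_; _≤_; _<_; z≤n; s≤s; z<s; _≟_; _<?_)
open import Data.Nat.DivMod using (m≡m%n+[m/n]*n; m%n<n; %-distribˡ-*)
open import Data.Nat.Properties
open import Data.Product using (_×_; _,_; proj₁; proj₂; ∃-syntax; swap; map₁)
open import Data.Product.Properties using (≡-dec)
open import Data.Sum as Sum using (_⊎_; inj₁; inj₂; [_,_])
open import Function using (_∘_; id)
open import Function.Definitions using (Injective)
open import Level using (0ℓ)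
open import Relation.Binary.Definitions using (DecidableEquality)
open import Relation.Binary.PropositionalEquality
  using (_≡_; _≢_; ≢-sym; refl; sym; trans; cong; cong₂; subst; setoid)
open import Relation.Nullary using (Dec; yes; no)
open import Relation.Nullary.Decidable using (True; toWitness; ¬?; _×-dec_; _⊎-dec_; _→-dec_)
open import Relation.Unary using (Pred; Decidable; _⊆_; _≐_; _∪_; _⊥_; _⊢_)
open import Relation.Unary.Properties using (≐-sym)

Region : Set₁
Region = Pred Cell 0ℓ

Tileable : Region → Set
Tileable = TileableByRightTrominoes

tiles-∪ : ∀ {T U A B} → A ⊥ B → Tiles T A → Tiles U B → Tiles (T ++ U) (A ∪ B)
tiles-∪ {T} {U} A⊥B (uniqueT , T⊆A , A⊆T) (uniqueU , U⊆B , B⊆U) rewrite concatMap-++ cells T U =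
  Unique.++⁺ uniqueT uniqueU (λ (x∈T , x∈U) → A⊥B (T⊆A _ x∈T , U⊆B _ x∈U)) ,
  (λ x x∈ → Sum.map (T⊆A x) (U⊆B x) (∈-++⁻ _ x∈)) ,
  (λ x → [ ∈-++⁺ˡ ∘ A⊆T x , ∈-++⁺ʳ _ ∘ B⊆U x ])

tileable-∪ : ∀ {A B} → A ⊥ B → Tileable A → Tileable B → Tileable (A ∪ B)
tileable-∪ A⊥B (T , tilesA) (U , tilesB) = T ++ U , tiles-∪ {T} {U} A⊥B tilesA tilesB

tileable-resp-≐ : ∀ {A B} → A ≐ B → Tileable A → Tileable B
tileable-resp-≐ (A⊆B , B⊆A) (T , unique , T⊆A , A⊆T) =
  T , unique , (λ x x∈ → A⊆B (T⊆A x x∈)) , (λ x Bx → A⊆T x (B⊆A Bx))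

Image : (Cell → Cell) → Region → Region
Image f R y = ∃[ x ] R x × y ≡ f x

module _ (f : Cell → Cell) (g : Tromino → Tromino)
         (cells-g : ∀ t → cells (g t) ↭ map f (cells t)) where

  concatMap-cells-↭ : ∀ T → concatMap cells (map g T) ↭ map f (concatMap cells T)
  concatMap-cells-↭ [] = ↭-refl
  concatMap-cells-↭ (t ∷ T) =
    ↭-trans (++⁺ (cells-g t) (concatMap-cells-↭ T)) (↭-reflexive (sym (map-++ f (cells t) _)))

  tiles-image : ∀ {T R} → Injective _≡_ _≡_ f → Tiles T R → Tiles (map g T) (Image f R)
  tiles-image {T} {R} f-inj (unique , T⊆R , R⊆T) =
    Permutationₛ.Unique-resp-↭ (setoid Cell) (↭⇒↭ₛ (↭-sym π)) (Unique.map⁺ f-inj unique) ,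
    T⊆Image , Image⊆T
    where
    π = concatMap-cells-↭ T
    T⊆Image : ∀ y → y ∈ concatMap cells (map g T) → Image f R y
    T⊆Image y y∈ with ∈-map⁻ f (∈-resp-↭ π y∈)
    ... | x , x∈ , refl = x , T⊆R x x∈ , refl
    Image⊆T : ∀ y → Image f R y → y ∈ concatMap cells (map g T)
    Image⊆T y (x , Rx , refl) = ∈-resp-↭ (↭-sym π) (∈-map⁺ f (R⊆T x Rx))

  tileable-image : ∀ {R} → Injective _≡_ _≡_ f → Tileable R → Tileable (Image f R)
  tileable-image f-inj (T , tilesR) = map g T , tiles-image {T} f-inj tilesR

shiftRows : ℕ → Cell → Cell
shiftRows a (r , c) = (a + r , c)

shiftRows-injective : ∀ a → Injective _≡_ _≡_ (shiftRows a)
shiftRows-injective a {r , c} {r′ , c′} eq =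
  cong₂ _,_ (+-cancelˡ-≡ a r r′ (cong proj₁ eq)) (cong proj₂ eq)

shiftRowsᵗ : ℕ → Tromino → Tromino
shiftRowsᵗ a (tromino x k) = tromino (shiftRows a x) k

cells-shiftRows : ∀ a t → cells (shiftRowsᵗ a t) ↭ map (shiftRows a) (cells t)
cells-shiftRows a (tromino (r , c) zero)                   rewrite +-suc a r = ↭-refl
cells-shiftRows a (tromino (r , c) (suc zero))             rewrite +-suc a r = ↭-refl
cells-shiftRows a (tromino (r , c) (suc (suc zero)))       rewrite +-suc a r = ↭-refl
cells-shiftRows a (tromino (r , c) (suc (suc (suc zero)))) rewrite +-suc a r = ↭-refl

tileable-shiftRows : ∀ a {R} → Tileable R → Tileable (Image (shiftRows a) R)
tileable-shiftRows a =
  tileable-image (shiftRows a) (shiftRowsᵗ a) (cells-shiftRows a) (shiftRows-injective a)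

transposeᵗ : Tromino → Tromino
transposeᵗ (tromino x zero)                   = tromino (swap x) zero
transposeᵗ (tromino x (suc zero))             = tromino (swap x) (suc (suc zero))
transposeᵗ (tromino x (suc (suc zero)))       = tromino (swap x) (suc zero)
transposeᵗ (tromino x (suc (suc (suc zero)))) = tromino (swap x) (suc (suc (suc zero)))

cells-transpose : ∀ t → cells (transposeᵗ t) ↭ map swap (cells t)
cells-transpose (tromino x zero)                   = ↭-swap _ _ ↭-refl
cells-transpose (tromino x (suc zero))             = ↭-refl
cells-transpose (tromino x (suc (suc zero)))       = ↭-refl
cells-transpose (tromino x (suc (suc (suc zero)))) = ↭-prep _ (↭-swap _ _ ↭-refl)

tileable-transpose : ∀ {R} → Tileable R → Tileable (swap ⊢ R)
tileable-transpose =
  tileable-resp-≐ ((λ { (x , Rx , refl) → Rx }) , λ {y} Rswapy → swap y , Rswapy , refl)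
  ∘ tileable-image swap transposeᵗ cells-transpose (cong swap)

rect-transpose : ∀ m n → swap ⊢ InRect m n ≐ InRect n m
rect-transpose m n = swap , swap

rect-split : ∀ a b n → InRect (a + b) n ≐ InRect a n ∪ Image (shiftRows a) (InRect b n)
rect-split a b n = split , join
  where
  split : InRect (a + b) n ⊆ InRect a n ∪ Image (shiftRows a) (InRect b n)
  split {r , c} (r<a+b , c<n) with r <? a
  ... | yes r<a = inj₁ (r<a , c<n)
  ... | no r≮a  = inj₂ ((r ∸ a , c) , (r∸a<b , c<n) , cong (_, c) (sym a+[r∸a]≡r))
    where
    a+[r∸a]≡r = m+[n∸m]≡n (≮⇒≥ r≮a)
    r∸a<b = +-cancelˡ-< a (r ∸ a) b (subst (_< a + b) (sym a+[r∸a]≡r) r<a+b)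
  join : InRect a n ∪ Image (shiftRows a) (InRect b n) ⊆ InRect (a + b) n
  join (inj₁ (r<a , c<n))                 = <-≤-trans r<a (m≤m+n a b) , c<n
  join (inj₂ (_ , (r<b , c<n) , refl)) = +-monoʳ-< a r<b , c<n

rect-⊥-shiftRows : ∀ a n {R} → InRect a n ⊥ Image (shiftRows a) R
rect-⊥-shiftRows a n ((a+r<a , _) , (r , _) , _ , refl) = m+n≮m a r a+r<a

tileable-rect-stack : ∀ a b n →
  Tileable (InRect a n) → Tileable (InRect b n) → Tileable (InRect (a + b) n)
tileable-rect-stack a b n tileA tileB =
  tileable-resp-≐ (≐-sym (rect-split a b n))
    (tileable-∪ (rect-⊥-shiftRows a n) tileA (tileable-shiftRows a tileB))

shiftRows-≢ : ∀ a {x} y → proj₁ x < a → shiftRows a y ≢ x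
shiftRows-≢ a (r , _) x<a refl = m+n≮m a r x<a

rectMinus-stackBelow : ∀ a b n {p q} → proj₁ p < a → proj₁ q < a →
  RectMinus a n p q ∪ Image (shiftRows a) (InRect b n) ≐ RectMinus (a + b) n p q
rectMinus-stackBelow a b n {p} {q} p<a q<a = join , split
  where
  join : RectMinus a n p q ∪ Image (shiftRows a) (InRect b n) ⊆ RectMinus (a + b) n p q
  join (inj₁ (x∈A , x≢p , x≢q)) = proj₂ (rect-split a b n) (inj₁ x∈A) , x≢p , x≢q
  join (inj₂ x∈B@(y , _ , refl)) =
    proj₂ (rect-split a b n) (inj₂ x∈B) , shiftRows-≢ a y p<a , shiftRows-≢ a y q<a
  split : RectMinus (a + b) n p q ⊆ RectMinus a n p q ∪ Image (shiftRows a) (InRect b n)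
  split (x∈R , x≢p , x≢q) = Sum.map₁ (_, x≢p , x≢q) (proj₁ (rect-split a b n) x∈R)

rectMinus-stackAbove : ∀ a b n p q →
  InRect a n ∪ Image (shiftRows a) (RectMinus b n p q) ≐
  RectMinus (a + b) n (shiftRows a p) (shiftRows a q)
rectMinus-stackAbove a b n p q = join , split
  where
  join : InRect a n ∪ Image (shiftRows a) (RectMinus b n p q) ⊆
         RectMinus (a + b) n (shiftRows a p) (shiftRows a q)
  join (inj₁ x∈A@(x<a , _)) =
    proj₂ (rect-split a b n) (inj₁ x∈A) , ≢-sym (shiftRows-≢ a p x<a) , ≢-sym (shiftRows-≢ a q x<a)
  join (inj₂ (y , (y∈B , y≢p , y≢q) , refl)) =
    proj₂ (rect-split a b n) (inj₂ (y , y∈B , refl)) ,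
    y≢p ∘ shiftRows-injective a , y≢q ∘ shiftRows-injective a
  split : RectMinus (a + b) n (shiftRows a p) (shiftRows a q) ⊆
          InRect a n ∪ Image (shiftRows a) (RectMinus b n p q)
  split (x∈R , x≢p , x≢q) with proj₁ (rect-split a b n) x∈R
  ... | inj₁ x∈A              = inj₁ x∈A
  ... | inj₂ (y , y∈B , refl) =
    inj₂ (y , (y∈B , x≢p ∘ cong (shiftRows a) , x≢q ∘ cong (shiftRows a)) , refl)

tileable-rectMinus-stackBelow : ∀ a b n {p q} → proj₁ p < a → proj₁ q < a →
  Tileable (RectMinus a n p q) → Tileable (InRect b n) → Tileable (RectMinus (a + b) n p q)
tileable-rectMinus-stackBelow a b n p<a q<a tileA tileB =
  tileable-resp-≐ (rectMinus-stackBelow a b n p<a q<a)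
    (tileable-∪ (rect-⊥-shiftRows a n ∘ map₁ proj₁) tileA (tileable-shiftRows a tileB))

tileable-rectMinus-stackAbove : ∀ a b n p q →
  Tileable (InRect a n) → Tileable (RectMinus b n p q) →
  Tileable (RectMinus (a + b) n (shiftRows a p) (shiftRows a q))
tileable-rectMinus-stackAbove a b n p q tileA tileB =
  tileable-resp-≐ (rectMinus-stackAbove a b n p q)
    (tileable-∪ (rect-⊥-shiftRows a n) tileA (tileable-shiftRows a tileB))

CornerDominoTileable : ℕ → ℕ → Set
CornerDominoTileable m n = (p q : Cell) →
  InRect m n p → InRect m n q → Adjacent p q → IsCorner m n p → Tileable (RectMinus m n p q)

rectMinus-transpose : ∀ m n p q → swap ⊢ RectMinus m n (swap p) (swap q) ≐ RectMinus n m p q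
rectMinus-transpose m n p q = transpose , transpose
  where
  transpose : ∀ {m n p q x} → RectMinus m n p q x → RectMinus n m (swap p) (swap q) (swap x)
  transpose (x∈R , x≢p , x≢q) = swap x∈R , x≢p ∘ cong swap , x≢q ∘ cong swap

cornerDominoTileable-transpose : ∀ {m n} → CornerDominoTileable m n → CornerDominoTileable n m
cornerDominoTileable-transpose {m} {n} tileable p q p∈R q∈R p~q p-corner =
  tileable-resp-≐ (rectMinus-transpose m n p q)
    (tileable-transpose (tileable (swap p) (swap q) (swap p∈R) (swap q∈R) (Sum.swap p~q) (swap p-corner)))

adjacent-firstRow : ∀ {c q} → Adjacent (0 , c) q → proj₁ q ≤ 1
adjacent-firstRow (inj₁ (refl , _))       = z≤n
adjacent-firstRow (inj₂ (_ , inj₁ refl)) = ≤-refl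

adjacent-lastRow : ∀ k j {c q} → Adjacent (k + suc j , c) q → proj₁ q < k + (2 + j) →
  ∃[ q′ ] q ≡ shiftRows k q′ × Adjacent (suc j , c) q′ × proj₁ q′ < 2 + j
adjacent-lastRow k j (inj₁ (refl , c~c′)) _ = (suc j , _) , refl , inj₁ (refl , c~c′) , ≤-refl
adjacent-lastRow k j (inj₂ (refl , inj₁ refl)) q<k+2+j =
  ⊥-elim (<-irrefl (sym (+-suc k (suc j))) q<k+2+j)
adjacent-lastRow k j {c} {r′ , _} (inj₂ (refl , inj₂ 1+r′≡k+1+j)) _
  with suc-injective (trans 1+r′≡k+1+j (+-suc k j))
... | refl = (j , c) , refl , inj₂ (refl , inj₂ refl) , s≤s (n≤1+n j)

cornerDominoTileable-stackRows : ∀ k j n → Tileable (InRect k n) →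
  CornerDominoTileable (2 + j) n → CornerDominoTileable (k + (2 + j)) n
cornerDominoTileable-stackRows k j n strip tileable (0 , c) q p∈R q∈R p~q (inj₁ refl , c-corner) =
  subst (λ m → Tileable (RectMinus m n (0 , c) q)) (+-comm (2 + j) k)
    (tileable-rectMinus-stackBelow (2 + j) k n z<s q<2+j
      (tileable (0 , c) q (z<s , proj₂ p∈R) (q<2+j , proj₂ q∈R) p~q (inj₁ refl , c-corner)) strip)
  where
  q<2+j = s≤s (≤-trans (adjacent-firstRow p~q) (s≤s z≤n))
cornerDominoTileable-stackRows k j n strip tileable (r , c) q p∈R q∈R p~q (inj₂ 1+r≡k+2+j , c-corner)
  with suc-injective (trans 1+r≡k+2+j (+-suc k (suc j)))
... | refl with adjacent-lastRow k j p~q (proj₁ q∈R)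
... | q′ , refl , p′~q′ , q′<2+j =
  tileable-rectMinus-stackAbove k (2 + j) n (suc j , c) q′ strip
    (tileable (suc j , c) q′ (≤-refl , proj₂ p∈R) (q′<2+j , proj₂ q∈R) p′~q′
              (inj₂ refl , c-corner))

cornerDominoTileable-stackCols : ∀ m k j → Tileable (InRect m k) →
  CornerDominoTileable m (2 + j) → CornerDominoTileable m (k + (2 + j))
cornerDominoTileable-stackCols m k j strip =
  cornerDominoTileable-transpose
  ∘ cornerDominoTileable-stackRows k j m (tileable-resp-≐ (rect-transpose m k) (tileable-transpose strip))
  ∘ cornerDominoTileable-transpose

_≟ᶜ_ : DecidableEquality Cell
_≟ᶜ_ = ≡-dec _≟_ _≟_

open import Data.List.Relation.Unary.Unique.DecPropositional _≟ᶜ_ using (unique?)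
open import Data.List.Membership.DecPropositional _≟ᶜ_ using (_∈?_)

rectCells : ℕ → ℕ → List Cell
rectCells m n = concatMap (λ r → map (r ,_) (upTo n)) (upTo m)

∈-rectCells : ∀ {m n} → InRect m n ⊆ (_∈ rectCells m n)
∈-rectCells {m} {n} {r , c} (r<m , c<n) =
  ∈-concat⁺′ (∈-map⁺ (r ,_) (∈-upTo⁺ c<n))
             (∈-map⁺ (λ r → map (r ,_) (upTo n)) (∈-upTo⁺ r<m))

TilesWithin : ℕ → ℕ → List Tromino → Region → Set
TilesWithin m n T R =
  Unique (concatMap cells T) × All R (concatMap cells T) ×
  All (λ x → R x → x ∈ concatMap cells T) (rectCells m n)

tilesWithin? : ∀ {R} → Decidable R → ∀ m n T → Dec (TilesWithin m n T R)
tilesWithin? R? m n T =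
  unique? (concatMap cells T) ×-dec all? R? (concatMap cells T) ×-dec
  all? (λ x → R? x →-dec x ∈? concatMap cells T) (rectCells m n)

tilesWithin⇒tiles : ∀ {R m n T} → R ⊆ InRect m n → TilesWithin m n T R → Tiles T R
tilesWithin⇒tiles R⊆rect (unique , T⊆R , R⊆T) =
  unique , (λ _ → All.lookup T⊆R) , (λ _ Rx → All.lookup R⊆T (∈-rectCells (R⊆rect Rx)) Rx)

inRect? : ∀ m n → Decidable (InRect m n)
inRect? m n (r , c) = r <? m ×-dec c <? n

tileable-rect-by-decision : ∀ m n (T : List Tromino) → {True (tilesWithin? (inRect? m n) m n T)} →
  Tileable (InRect m n)
tileable-rect-by-decision m n T {ok} = T , tilesWithin⇒tiles {T = T} id (toWitness ok)

L : ℕ → ℕ → (k : ℕ) → {True (k <? 4)} → Tromino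
L r c k {k<4} = tromino (r , c) (#_ k {m<n = k<4})

tileable-2×6 : Tileable (InRect 2 6)
tileable-2×6 = tileable-rect-by-decision 2 6 (L 0 0 1 ∷ L 0 1 2 ∷ L 0 3 1 ∷ L 0 4 2 ∷ [])

tileable-3×6 : Tileable (InRect 3 6)
tileable-3×6 = tileable-rect-by-decision 3 6
  (L 0 0 2 ∷ L 0 2 2 ∷ L 0 4 2 ∷ L 1 0 1 ∷ L 1 2 1 ∷ L 1 4 1 ∷ [])

tileable-rows×6 : ∀ m → Tileable (InRect (2 + m) 6)
tileable-rows×6 0             = tileable-2×6
tileable-rows×6 1             = tileable-3×6
tileable-rows×6 (suc (suc m)) = tileable-rect-stack 2 (2 + m) 6 tileable-2×6 (tileable-rows×6 m)

tileable-6×cols : ∀ n → Tileable (InRect 6 (2 + n))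
tileable-6×cols n = tileable-resp-≐ (rect-transpose (2 + n) 6) (tileable-transpose (tileable-rows×6 n))

rectMinus? : ∀ m n p q → Decidable (RectMinus m n p q)
rectMinus? m n p q x = inRect? m n x ×-dec ¬? (x ≟ᶜ p) ×-dec ¬? (x ≟ᶜ q)

adjacent? : ∀ p q → Dec (Adjacent p q)
adjacent? (r , c) (r′ , c′) =
  (r ≟ r′ ×-dec (suc c ≟ c′ ⊎-dec suc c′ ≟ c)) ⊎-dec
  (c ≟ c′ ×-dec (suc r ≟ r′ ⊎-dec suc r′ ≟ r))

isCorner? : ∀ m n → Decidable (IsCorner m n)
isCorner? m n (r , c) = (r ≟ 0 ⊎-dec suc r ≟ m) ×-dec (c ≟ 0 ⊎-dec suc c ≟ n)

corners : ℕ → ℕ → List Cell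
corners m n = (0 , 0) ∷ (0 , pred n) ∷ (pred m , 0) ∷ (pred m , pred n) ∷ []

∈-corners : ∀ {m n} → IsCorner m n ⊆ (_∈ corners m n)
∈-corners (inj₁ refl , inj₁ refl) = here refl
∈-corners (inj₁ refl , inj₂ refl) = there (here refl)
∈-corners (inj₂ refl , inj₁ refl) = there (there (here refl))
∈-corners (inj₂ refl , inj₂ refl) = there (there (there (here refl)))

neighbours : Cell → List Cell
neighbours (r , c) = (r , suc c) ∷ (r , pred c) ∷ (suc r , c) ∷ (pred r , c) ∷ []

∈-neighbours : ∀ {p} → Adjacent p ⊆ (_∈ neighbours p)
∈-neighbours (inj₁ (refl , inj₁ refl)) = here refl
∈-neighbours (inj₁ (refl , inj₂ refl)) = there (here refl)
∈-neighbours (inj₂ (refl , inj₁ refl)) = there (there (here refl))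
∈-neighbours (inj₂ (refl , inj₂ refl)) = there (there (there (here refl)))

DominoTilings : Set
DominoTilings = List (Cell × Cell × List Tromino)

Solves : ℕ → ℕ → Cell → Cell → Cell × Cell × List Tromino → Set
Solves m n p q (p′ , q′ , T) = p ≡ p′ × q ≡ q′ × TilesWithin m n T (RectMinus m n p q)

solves? : ∀ m n p q → Decidable (Solves m n p q)
solves? m n p q (p′ , q′ , T) =
  p ≟ᶜ p′ ×-dec q ≟ᶜ q′ ×-dec tilesWithin? (rectMinus? m n p q) m n T

AllCornerDominoesSolved : ℕ → ℕ → DominoTilings → Set
AllCornerDominoesSolved m n tilings = All (λ p → All (λ q →
  InRect m n p × InRect m n q × Adjacent p q × IsCorner m n p → Any (Solves m n p q) tilings)
  (neighbours p)) (corners m n)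

allCornerDominoesSolved? : ∀ m n tilings → Dec (AllCornerDominoesSolved m n tilings)
allCornerDominoesSolved? m n tilings = all? (λ p → all? (λ q →
  (inRect? m n p ×-dec inRect? m n q ×-dec adjacent? p q ×-dec isCorner? m n p) →-dec
  any? (solves? m n p q) tilings)
  (neighbours p)) (corners m n)

cornerDominoTileable-by-decision : ∀ m n tilings → {True (allCornerDominoesSolved? m n tilings)} →
  CornerDominoTileable m n
cornerDominoTileable-by-decision m n tilings {ok} p q p∈R q∈R p~q p-corner
  with satisfied (All.lookup (All.lookup (toWitness ok) (∈-corners p-corner)) (∈-neighbours p~q)
                    (p∈R , q∈R , p~q , p-corner))
... | (_ , _ , T) , refl , refl , tilesWithin = T , tilesWithin⇒tiles {T = T} proj₁ tilesWithin

tilings-4×5 : DominoTilings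
tilings-4×5 =
  ((0 , 0) , (0 , 1) , L 0 2 1 ∷ L 0 3 2 ∷ L 1 0 2 ∷ L 2 0 1 ∷ L 2 2 1 ∷ L 2 3 2 ∷ [])
  ∷ ((0 , 0) , (1 , 0) , L 0 1 3 ∷ L 0 3 2 ∷ L 1 2 2 ∷ L 2 0 1 ∷ L 2 1 2 ∷ L 2 3 0 ∷ [])
  ∷ ((0 , 4) , (0 , 3) , L 0 0 1 ∷ L 0 1 2 ∷ L 1 3 2 ∷ L 2 0 1 ∷ L 2 1 2 ∷ L 2 3 1 ∷ [])
  ∷ ((0 , 4) , (1 , 4) , L 0 0 3 ∷ L 0 2 2 ∷ L 1 1 3 ∷ L 2 0 1 ∷ L 2 2 1 ∷ L 2 3 2 ∷ [])
  ∷ ((3 , 0) , (3 , 1) , L 0 0 2 ∷ L 0 2 1 ∷ L 0 3 2 ∷ L 1 0 1 ∷ L 2 2 1 ∷ L 2 3 2 ∷ [])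
  ∷ ((3 , 0) , (2 , 0) , L 0 0 1 ∷ L 0 1 2 ∷ L 0 3 2 ∷ L 1 2 0 ∷ L 2 1 1 ∷ L 2 3 0 ∷ [])
  ∷ ((3 , 4) , (3 , 3) , L 0 0 1 ∷ L 0 1 2 ∷ L 0 3 2 ∷ L 1 3 1 ∷ L 2 0 1 ∷ L 2 1 2 ∷ [])
  ∷ ((3 , 4) , (2 , 4) , L 0 0 3 ∷ L 0 2 1 ∷ L 0 3 2 ∷ L 1 1 1 ∷ L 2 0 1 ∷ L 2 2 0 ∷ [])
  ∷ []

tilings-4×8 : DominoTilings
tilings-4×8 =
  ((0 , 0) , (0 , 1) , L 0 2 1 ∷ L 0 3 2 ∷ L 0 5 1 ∷ L 0 6 2 ∷ L 1 0 2 ∷ L 2 0 1 ∷ L 2 2 1 ∷ L 2 3 2 ∷ L 2 5 1 ∷ L 2 6 2 ∷ [])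
  ∷ ((0 , 0) , (1 , 0) , L 0 1 1 ∷ L 0 2 2 ∷ L 0 4 3 ∷ L 0 6 2 ∷ L 1 5 2 ∷ L 2 0 1 ∷ L 2 1 2 ∷ L 2 3 1 ∷ L 2 4 2 ∷ L 2 6 0 ∷ [])
  ∷ ((0 , 7) , (0 , 6) , L 0 0 1 ∷ L 0 1 2 ∷ L 0 3 1 ∷ L 0 4 2 ∷ L 1 6 2 ∷ L 2 0 1 ∷ L 2 1 2 ∷ L 2 3 1 ∷ L 2 4 2 ∷ L 2 6 1 ∷ [])
  ∷ ((0 , 7) , (1 , 7) , L 0 0 1 ∷ L 0 1 2 ∷ L 0 3 3 ∷ L 0 5 2 ∷ L 1 4 3 ∷ L 2 0 1 ∷ L 2 1 2 ∷ L 2 3 1 ∷ L 2 5 1 ∷ L 2 6 2 ∷ [])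
  ∷ ((3 , 0) , (3 , 1) , L 0 0 2 ∷ L 0 2 1 ∷ L 0 3 2 ∷ L 0 5 1 ∷ L 0 6 2 ∷ L 1 0 1 ∷ L 2 2 1 ∷ L 2 3 2 ∷ L 2 5 1 ∷ L 2 6 2 ∷ [])
  ∷ ((3 , 0) , (2 , 0) , L 0 0 1 ∷ L 0 1 2 ∷ L 0 3 1 ∷ L 0 4 2 ∷ L 0 6 2 ∷ L 1 5 0 ∷ L 2 1 1 ∷ L 2 2 2 ∷ L 2 4 1 ∷ L 2 6 0 ∷ [])
  ∷ ((3 , 7) , (3 , 6) , L 0 0 1 ∷ L 0 1 2 ∷ L 0 3 1 ∷ L 0 4 2 ∷ L 0 6 2 ∷ L 1 6 1 ∷ L 2 0 1 ∷ L 2 1 2 ∷ L 2 3 1 ∷ L 2 4 2 ∷ [])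
  ∷ ((3 , 7) , (2 , 7) , L 0 0 1 ∷ L 0 1 2 ∷ L 0 3 3 ∷ L 0 5 1 ∷ L 0 6 2 ∷ L 1 4 1 ∷ L 2 0 1 ∷ L 2 1 2 ∷ L 2 3 1 ∷ L 2 5 0 ∷ [])
  ∷ []

tilings-7×5 : DominoTilings
tilings-7×5 =
  ((0 , 0) , (0 , 1) , L 0 2 1 ∷ L 0 3 2 ∷ L 1 0 3 ∷ L 2 1 2 ∷ L 2 3 2 ∷ L 3 0 3 ∷ L 3 3 1 ∷ L 4 1 3 ∷ L 5 0 1 ∷ L 5 2 1 ∷ L 5 3 2 ∷ [])
  ∷ ((0 , 0) , (1 , 0) , L 0 1 2 ∷ L 0 3 2 ∷ L 1 1 1 ∷ L 1 3 1 ∷ L 2 0 1 ∷ L 3 2 1 ∷ L 3 3 2 ∷ L 4 0 2 ∷ L 5 0 1 ∷ L 5 2 1 ∷ L 5 3 2 ∷ [])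
  ∷ ((0 , 4) , (0 , 3) , L 0 0 1 ∷ L 0 1 2 ∷ L 1 3 2 ∷ L 2 0 2 ∷ L 2 2 3 ∷ L 3 0 1 ∷ L 3 3 2 ∷ L 4 2 2 ∷ L 5 0 1 ∷ L 5 1 2 ∷ L 5 3 0 ∷ [])
  ∷ ((0 , 4) , (1 , 4) , L 0 0 2 ∷ L 0 2 2 ∷ L 1 0 1 ∷ L 1 2 1 ∷ L 2 3 0 ∷ L 3 0 1 ∷ L 3 1 2 ∷ L 4 3 2 ∷ L 5 0 1 ∷ L 5 1 2 ∷ L 5 3 1 ∷ [])
  ∷ ((6 , 0) , (6 , 1) , L 0 0 1 ∷ L 0 1 2 ∷ L 0 3 2 ∷ L 1 3 1 ∷ L 2 0 1 ∷ L 2 1 2 ∷ L 3 3 2 ∷ L 4 0 3 ∷ L 4 2 2 ∷ L 5 1 2 ∷ L 5 3 0 ∷ [])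
  ∷ ((6 , 0) , (5 , 0) , L 0 0 1 ∷ L 0 1 2 ∷ L 0 3 2 ∷ L 1 3 1 ∷ L 2 0 1 ∷ L 2 1 2 ∷ L 3 3 2 ∷ L 4 0 2 ∷ L 4 2 2 ∷ L 5 1 0 ∷ L 5 3 0 ∷ [])
  ∷ ((6 , 4) , (6 , 3) , L 0 0 1 ∷ L 0 1 2 ∷ L 0 3 2 ∷ L 1 2 0 ∷ L 2 0 2 ∷ L 2 3 0 ∷ L 3 0 1 ∷ L 3 2 1 ∷ L 4 3 0 ∷ L 5 0 1 ∷ L 5 1 2 ∷ [])
  ∷ ((6 , 4) , (5 , 4) , L 0 0 1 ∷ L 0 1 2 ∷ L 0 3 2 ∷ L 1 3 1 ∷ L 2 0 1 ∷ L 2 1 2 ∷ L 3 3 2 ∷ L 4 0 2 ∷ L 4 2 2 ∷ L 5 0 1 ∷ L 5 2 1 ∷ [])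
  ∷ []

tilings-7×8 : DominoTilings
tilings-7×8 =
  ((0 , 0) , (0 , 1) , L 0 2 1 ∷ L 0 3 2 ∷ L 0 5 1 ∷ L 0 6 2 ∷ L 1 0 2 ∷ L 2 0 1 ∷ L 2 2 1 ∷ L 2 3 2 ∷ L 2 5 1 ∷ L 2 6 2 ∷ L 4 0 2 ∷ L 4 2 2 ∷ L 4 4 2 ∷ L 4 6 2 ∷ L 5 0 1 ∷ L 5 2 1 ∷ L 5 4 1 ∷ L 5 6 1 ∷ [])
  ∷ ((0 , 0) , (1 , 0) , L 0 1 1 ∷ L 0 2 2 ∷ L 0 4 2 ∷ L 0 6 2 ∷ L 1 4 1 ∷ L 1 6 1 ∷ L 2 0 1 ∷ L 2 1 2 ∷ L 2 3 1 ∷ L 3 4 0 ∷ L 3 6 2 ∷ L 4 0 2 ∷ L 4 2 2 ∷ L 4 5 0 ∷ L 5 0 1 ∷ L 5 2 1 ∷ L 5 4 1 ∷ L 5 6 0 ∷ [])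
  ∷ ((0 , 7) , (0 , 6) , L 0 0 1 ∷ L 0 1 2 ∷ L 0 3 1 ∷ L 0 4 2 ∷ L 1 6 2 ∷ L 2 0 1 ∷ L 2 1 2 ∷ L 2 3 1 ∷ L 2 4 2 ∷ L 2 6 1 ∷ L 4 0 2 ∷ L 4 2 2 ∷ L 4 4 2 ∷ L 4 6 2 ∷ L 5 0 1 ∷ L 5 2 1 ∷ L 5 4 1 ∷ L 5 6 1 ∷ [])
  ∷ ((0 , 7) , (1 , 7) , L 0 0 1 ∷ L 0 1 2 ∷ L 0 3 2 ∷ L 0 5 2 ∷ L 1 3 1 ∷ L 1 5 1 ∷ L 2 0 1 ∷ L 2 1 2 ∷ L 2 6 0 ∷ L 3 2 0 ∷ L 3 4 2 ∷ L 4 0 2 ∷ L 4 3 0 ∷ L 4 6 2 ∷ L 5 0 1 ∷ L 5 2 1 ∷ L 5 4 0 ∷ L 5 6 1 ∷ [])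
  ∷ ((6 , 0) , (6 , 1) , L 0 0 1 ∷ L 0 1 2 ∷ L 0 3 1 ∷ L 0 4 2 ∷ L 0 6 2 ∷ L 1 6 1 ∷ L 2 0 1 ∷ L 2 1 2 ∷ L 2 3 1 ∷ L 2 4 2 ∷ L 3 6 2 ∷ L 4 0 1 ∷ L 4 1 2 ∷ L 4 3 2 ∷ L 4 5 2 ∷ L 5 2 0 ∷ L 5 4 0 ∷ L 5 6 0 ∷ [])
  ∷ ((6 , 0) , (5 , 0) , L 0 0 1 ∷ L 0 1 2 ∷ L 0 3 1 ∷ L 0 4 2 ∷ L 0 6 2 ∷ L 1 6 1 ∷ L 2 0 1 ∷ L 2 1 2 ∷ L 2 3 2 ∷ L 2 5 1 ∷ L 3 2 0 ∷ L 3 6 0 ∷ L 4 0 2 ∷ L 4 4 3 ∷ L 5 1 0 ∷ L 5 3 1 ∷ L 5 5 1 ∷ L 5 6 2 ∷ [])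
  ∷ ((6 , 7) , (6 , 6) , L 0 0 1 ∷ L 0 1 2 ∷ L 0 3 1 ∷ L 0 4 2 ∷ L 0 6 2 ∷ L 1 6 1 ∷ L 2 0 1 ∷ L 2 1 2 ∷ L 2 3 1 ∷ L 2 4 2 ∷ L 3 6 2 ∷ L 4 0 2 ∷ L 4 2 2 ∷ L 4 4 2 ∷ L 4 6 1 ∷ L 5 0 1 ∷ L 5 2 1 ∷ L 5 4 1 ∷ [])
  ∷ ((6 , 7) , (5 , 7) , L 0 0 1 ∷ L 0 1 2 ∷ L 0 3 1 ∷ L 0 4 2 ∷ L 0 6 2 ∷ L 1 6 1 ∷ L 2 0 1 ∷ L 2 1 2 ∷ L 2 3 2 ∷ L 2 5 1 ∷ L 3 2 0 ∷ L 3 6 0 ∷ L 4 0 2 ∷ L 4 4 2 ∷ L 5 0 1 ∷ L 5 2 1 ∷ L 5 3 2 ∷ L 5 5 0 ∷ [])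
  ∷ []

cornerDominoTileable-4+3i×5+3j : ∀ i j → CornerDominoTileable (4 + i * 3) (5 + j * 3)
cornerDominoTileable-4+3i×5+3j 0 0 = cornerDominoTileable-by-decision 4 5 tilings-4×5
cornerDominoTileable-4+3i×5+3j 0 1 = cornerDominoTileable-by-decision 4 8 tilings-4×8
cornerDominoTileable-4+3i×5+3j 1 0 = cornerDominoTileable-by-decision 7 5 tilings-7×5
cornerDominoTileable-4+3i×5+3j 1 1 = cornerDominoTileable-by-decision 7 8 tilings-7×8
cornerDominoTileable-4+3i×5+3j 0 (suc (suc j)) =
  cornerDominoTileable-stackCols 4 6 (3 + j * 3) (tileable-rows×6 2) (cornerDominoTileable-4+3i×5+3j 0 j)
cornerDominoTileable-4+3i×5+3j 1 (suc (suc j)) =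
  cornerDominoTileable-stackCols 7 6 (3 + j * 3) (tileable-rows×6 5) (cornerDominoTileable-4+3i×5+3j 1 j)
cornerDominoTileable-4+3i×5+3j (suc (suc i)) j =
  cornerDominoTileable-stackRows 6 (2 + i * 3) (5 + j * 3) (tileable-6×cols (3 + j * 3))
    (cornerDominoTileable-4+3i×5+3j i j)

mod3-product≡2 : ∀ m n → (m * n) % 3 ≡ 2 → (m % 3 ≡ 1 × n % 3 ≡ 2) ⊎ (m % 3 ≡ 2 × n % 3 ≡ 1)
mod3-product≡2 m n mn%3≡2 =
  residues (m % 3) (n % 3) (m%n<n m 3) (m%n<n n 3) (trans (sym (%-distribˡ-* m n 3)) mn%3≡2)
  where
  residues : ∀ a b → a < 3 → b < 3 → (a * b) % 3 ≡ 2 → (a ≡ 1 × b ≡ 2) ⊎ (a ≡ 2 × b ≡ 1)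
  residues 0 _ _ _ ()
  residues 1 0 _ _ ()
  residues 1 1 _ _ ()
  residues 1 2 _ _ _ = inj₁ (refl , refl)
  residues 2 0 _ _ ()
  residues 2 1 _ _ _ = inj₂ (refl , refl)
  residues 2 2 _ _ ()
  residues (suc (suc (suc _))) _ (s≤s (s≤s (s≤s ()))) _ _
  residues 1 (suc (suc (suc _))) _ (s≤s (s≤s (s≤s ()))) _
  residues 2 (suc (suc (suc _))) _ (s≤s (s≤s (s≤s ()))) _

mod3-form : ∀ {r} m → 3 ≤ m → m % 3 ≡ r → ∃[ i ] m ≡ r + 3 + i * 3
mod3-form m 3≤m refl with m / 3 | m≡m%n+[m/n]*n m 3
... | zero  | m≡m%3+0 =
  ⊥-elim (<⇒≱ (subst (_< 3) (sym (trans m≡m%3+0 (+-identityʳ _))) (m%n<n m 3)) 3≤m)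
... | suc i | m≡m%3+3+3i = i , trans m≡m%3+3+3i (sym (+-assoc (m % 3) 3 (i * 3)))

theorem3 : (m n : ℕ) → 4 ≤ m → 4 ≤ n → (m * n) % 3 ≡ 2 →
    (p q : Cell) → InRect m n p → InRect m n q → Adjacent p q → IsCorner m n p →
    TileableByRightTrominoes (RectMinus m n p q)
theorem3 m n 4≤m 4≤n mn%3≡2 with mod3-product≡2 m n mn%3≡2
... | inj₁ (m%3≡1 , n%3≡2) with mod3-form m (<⇒≤ 4≤m) m%3≡1 | mod3-form n (<⇒≤ 4≤n) n%3≡2
...   | i , refl | j , refl = cornerDominoTileable-4+3i×5+3j i j
theorem3 m n 4≤m 4≤n mn%3≡2
    | inj₂ (m%3≡2 , n%3≡1) with mod3-form n (<⇒≤ 4≤n) n%3≡1 | mod3-form m (<⇒≤ 4≤m) m%3≡2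
...   | i , refl | j , refl = cornerDominoTileable-transpose (cornerDominoTileable-4+3i×5+3j i j)
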